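{- Let $N_0(n)$ be the number of vertices of $\mathcal{K}(n)$ in the DSC process. Then $N_0(0)=1$, $N_0(n)=nN_0(n-1)+1$ for $n\ge1$, and $$N_0(n)=n!\Big[e-\sum_{k>n}\frac{1}{k!}\Big].$$ Moreover, as $n\to\infty$, $$N_0(n)=e\,n!-\frac1n+\frac1{n^3}-\frac1{n^4}-\frac2{n^5}+O(n^{ -6}).$$
   Context: The DSC process: $\mathcal{K}(0)$ consists of a single vertex. For $n\ge 1$, $\mathcal{K}(n)$ is obtained from $\mathcal{K}(n-1)$ by adding, for every simplex $\sigma$ of $\mathcal{K}(n-1)$ (of every dimension, vertices included), a new vertex $w_\sigma$ together with the simplex $\sigma\cup\{w_\sigma\}$ and all its faces (distinct simplices receive distinct new vertices). -}

module Defs where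

open import Data.Nat as ℕ using (ℕ; zero; suc; _⊔_; _^_; _!; NonZero)
open import Data.Nat.Properties using (_≟_; _!≢0; m^n≢0)
open import Data.List using (List; []; _∷_; _++_; [_]; map; concat; foldr; zipWith; upTo; length; deduplicate)
open import Data.Integer using (+_)
open import Data.Rational as ℚ using (ℚ; _/_; 0ℚ)

-- Vertices are natural numbers; a simplex is the (strictly increasing)
-- list of its vertices; a complex is the list of all its (nonempty)
-- simplices, each listed once.

Simplex : Set
Simplex = List ℕ

Complex : Set
Complex = List Simplex

subsets : Simplex → List Simplex
subsets [] = [] ∷ []
subsets (x ∷ xs) = subsets xs ++ map (x ∷_) (subsets xs)

fresh : Complex → ℕ
fresh K = suc (foldr _⊔_ 0 (concat K))

-- the faces of σ ∪ {w} that contain w (the other faces, i.e. the faces of σ,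
-- are already in the complex, which is closed under faces)
cone : ℕ → Simplex → List Simplex
cone w σ = map (_++ [ w ]) (subsets σ)

-- K(0) is a single vertex; K(n+1) adds, for the i-th simplex σ of K(n),
-- a new vertex w_σ = fresh + i together with σ ∪ {w_σ} and all its faces.
DSC : ℕ → Complex
DSC zero = (0 ∷ []) ∷ []
DSC (suc n) = K ++ concat (zipWith (λ i σ → cone (fresh K ℕ.+ i) σ) (upTo (length K)) K)
  where K = DSC n

vertices : Complex → List ℕ
vertices K = deduplicate _≟_ (concat K)

N₀ : ℕ → ℕ
N₀ n = length (vertices (DSC n))

ℕtoℚ : ℕ → ℚ
ℕtoℚ n = + n ℚ./ 1

invFact : ℕ → ℚ
invFact k = _/_ (+ 1) (k !) {{k !≢0}}

invPow : (n k : ℕ) → .{{NonZero n}} → ℚ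
invPow n k = _/_ (+ 1) (n ^ k) {{m^n≢0 n k}}

sumℚ : List ℚ → ℚ
sumℚ = foldr ℚ._+_ 0ℚ

eSum : ℕ → ℚ
eSum m = sumℚ (map invFact (upTo (suc m)))

tailSum : ℕ → ℕ → ℚ
tailSum n m = sumℚ (map (λ j → invFact (n ℕ.+ suc j)) (upTo m))

-- Each simplex of K(n) receives one new vertex, so N₀(n+1) = N₀(n) + f(n), where f(n) is the
-- number of simplices of K(n); the new labels are consecutive because the vertices of K(n) are
-- exactly 0, …, N₀(n) − 1. Weighting a simplex σ by y^|σ|, the cone over σ weighs y (1+y)^|σ|,
-- so the total weight F_y(n) of K(n) satisfies F_y(n+1) = F_y(n) + y F_{y+1}(n). Hence
-- F_y = y ψ_{y+1}, N₀ = ψ₁ and f = ψ₂ for ψ_y(0) = 1, ψ_y(n+1) = ψ_y(n) + y ψ_{y+1}(n), and the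
-- shift identity ψ_{y+1}(n+1) = ψ_y(n+1) + (n+1) ψ_{y+1}(n) gives f(n) = n N₀(n) + 1.
--
-- The recurrence makes N₀(n) = n! Σ_{k≤n} 1/k!. The remainder r_n(k) = n! Σ_{n<i≤n+k} 1/i! obeys
-- (n+1) r_n(k+1) = 1 + r_{n+1}(k), whence 0 ≤ n r_n(k) ≤ 1. Unfolding it five times and clearing
-- the denominator n⁶ (n+1)⋯(n+5) reduces the O(n⁻⁶) estimate to comparing polynomials with
-- natural coefficients.
module Submission where

open import Defs

module VertexCount where

  open import Data.Nat
  open import Data.Nat.Properties
  open import Data.Nat.Solver using (module +-*-Solver)
  open import Data.List
    using (List; []; _∷_; _++_; [_]; map; concat; foldr; zipWith; upTo; length; deduplicate)
  open import Data.List.Properties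
    using (length-++; concat-++; map-id; zipWith-map; length-map; length-upTo)
  open import Data.List.Membership.Propositional using (_∈_)
  open import Data.List.Membership.Propositional.Properties
  open import Data.List.Membership.Propositional.Properties.WithK using (unique∧set⇒bag)
  open import Data.List.Relation.Unary.Any using (here; there)
  open import Data.List.Relation.Unary.Unique.Propositional.Properties using (upTo⁺)
  open import Data.List.Relation.Unary.Unique.DecPropositional.Properties _≟_ using (deduplicate-!)
  open import Data.List.Relation.Binary.BagAndSetEquality using (∼bag⇒↭)
  open import Data.List.Relation.Binary.Permutation.Propositional.Properties using (↭-length)
  open import Data.Product using (_,_)
  open import Data.Sum using (_⊎_; inj₁; inj₂)
  open import Function using (_∘_; _⇔_; mk⇔; Equivalence)
  open import Relation.Binary.PropositionalEquality hiding ([_])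
  open import Relation.Nullary using (yes; no)
  open +-*-Solver

  conesOver : List ℕ → Complex → Complex
  conesOver ws K = concat (zipWith cone ws K)

  freshLabels : Complex → List ℕ
  freshLabels K = map (fresh K +_) (upTo (length K))

  length-freshLabels : ∀ K → length (freshLabels K) ≡ length K
  length-freshLabels K = trans (length-map (fresh K +_) (upTo (length K))) (length-upTo (length K))

  DSC-suc : ∀ n → DSC (suc n) ≡ DSC n ++ conesOver (freshLabels (DSC n)) (DSC n)
  DSC-suc n = cong (λ L → K ++ concat L) (begin
    zipWith (λ i σ → cone (fresh K + i) σ) (upTo (length K)) K
      ≡⟨ zipWith-map cone (fresh K +_) (λ σ → σ) (upTo (length K)) K ⟨
    zipWith cone (freshLabels K) (map (λ σ → σ) K)
      ≡⟨ cong (zipWith cone (freshLabels K)) (map-id K) ⟩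
    zipWith cone (freshLabels K) K ∎)
    where
    open ≡-Reasoning
    K : Complex
    K = DSC n

  facePoly : ℕ → Complex → ℕ
  facePoly y [] = 0
  facePoly y (σ ∷ K) = y ^ length σ + facePoly y K

  facePoly-++ : ∀ y K L → facePoly y (K ++ L) ≡ facePoly y K + facePoly y L
  facePoly-++ y [] L = refl
  facePoly-++ y (σ ∷ K) L =
    trans (cong (y ^ length σ +_) (facePoly-++ y K L)) (sym (+-assoc (y ^ length σ) _ _))

  facePoly-map-suc : ∀ y (f : Simplex → Simplex) → (∀ σ → length (f σ) ≡ suc (length σ)) →
                     ∀ K → facePoly y (map f K) ≡ y * facePoly y K
  facePoly-map-suc y f len [] = sym (*-zeroʳ y)
  facePoly-map-suc y f len (σ ∷ K) =
    trans (cong₂ _+_ (cong (y ^_) (len σ)) (facePoly-map-suc y f len K)) (sym (*-distribˡ-+ y _ _))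

  facePoly-subsets : ∀ y σ → facePoly y (subsets σ) ≡ suc y ^ length σ
  facePoly-subsets y [] = refl
  facePoly-subsets y (x ∷ σ) = begin
    facePoly y (subsets σ ++ map (x ∷_) (subsets σ))
      ≡⟨ facePoly-++ y (subsets σ) _ ⟩
    facePoly y (subsets σ) + facePoly y (map (x ∷_) (subsets σ))
      ≡⟨ cong (facePoly y (subsets σ) +_) (facePoly-map-suc y (x ∷_) (λ _ → refl) (subsets σ)) ⟩
    facePoly y (subsets σ) + y * facePoly y (subsets σ)
      ≡⟨ cong (λ a → a + y * a) (facePoly-subsets y σ) ⟩
    suc y ^ length σ + y * suc y ^ length σ ∎
    where open ≡-Reasoning

  facePoly-cone : ∀ y w σ → facePoly y (cone w σ) ≡ y * suc y ^ length σ
  facePoly-cone y w σ = trans (facePoly-map-suc y (_++ [ w ]) length-snoc (subsets σ))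
                              (cong (y *_) (facePoly-subsets y σ))
    where
    length-snoc : ∀ τ → length (τ ++ [ w ]) ≡ suc (length τ)
    length-snoc τ = trans (length-++ τ) (+-comm (length τ) 1)

  facePoly-conesOver : ∀ y ws K → length K ≤ length ws →
                       facePoly y (conesOver ws K) ≡ y * facePoly (suc y) K
  facePoly-conesOver y [] [] _ = sym (*-zeroʳ y)
  facePoly-conesOver y (w ∷ ws) [] _ = sym (*-zeroʳ y)
  facePoly-conesOver y (w ∷ ws) (σ ∷ K) (s≤s len) = begin
    facePoly y (cone w σ ++ conesOver ws K)
      ≡⟨ facePoly-++ y (cone w σ) _ ⟩
    facePoly y (cone w σ) + facePoly y (conesOver ws K)
      ≡⟨ cong₂ _+_ (facePoly-cone y w σ) (facePoly-conesOver y ws K len) ⟩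
    y * suc y ^ length σ + y * facePoly (suc y) K
      ≡⟨ *-distribˡ-+ y _ _ ⟨
    y * facePoly (suc y) (σ ∷ K) ∎
    where open ≡-Reasoning

  length≡facePoly₁ : ∀ K → length K ≡ facePoly 1 K
  length≡facePoly₁ [] = refl
  length≡facePoly₁ (σ ∷ K) = cong₂ _+_ (sym (^-zeroˡ (length σ))) (length≡facePoly₁ K)

  -- ψ y n = Σ_k C(n,k) · y (y+1) ⋯ (y+k−1)
  ψ : ℕ → ℕ → ℕ
  ψ y zero = 1
  ψ y (suc n) = ψ y n + y * ψ (suc y) n

  ψ-pos : ∀ y n → 0 < ψ y n
  ψ-pos y zero = s≤s z≤n
  ψ-pos y (suc n) = ≤-trans (ψ-pos y n) (m≤m+n _ _)

  ψ-shift : ∀ n y → ψ (suc y) (suc n) ≡ ψ y (suc n) + suc n * ψ (suc y) n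
  ψ-shift zero y = cong suc (+-comm 1 (y * 1))
  ψ-shift (suc n) y = begin
    ψ (suc y) (suc n) + suc y * ψ (suc (suc y)) (suc n)
      ≡⟨ cong₂ (λ a b → a + suc y * b) (ψ-shift n y) (ψ-shift n (suc y)) ⟩
    (ψ y (suc n) + suc n * c) + suc y * (c + suc y * d + suc n * d)
      ≡⟨ solve 5 (λ a c d y m →
           (a :+ m :* c) :+ (con 1 :+ y) :* (c :+ (con 1 :+ y) :* d :+ m :* d)
           := (a :+ y :* (c :+ (con 1 :+ y) :* d)) :+ (con 1 :+ m) :* (c :+ (con 1 :+ y) :* d))
         refl (ψ y (suc n)) c d y (suc n) ⟩
    ψ y (suc (suc n)) + suc (suc n) * ψ (suc y) (suc n) ∎
    where
    open ≡-Reasoning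
    c d : ℕ
    c = ψ (suc y) n
    d = ψ (suc (suc y)) n

  ψ₂ : ∀ n → ψ 2 n ≡ n * ψ 1 n + 1
  ψ₂ zero = refl
  ψ₂ (suc n) = begin
    ψ 2 (suc n)                                              ≡⟨ ψ-shift n 1 ⟩
    ψ 1 n + 1 * ψ 2 n + suc n * ψ 2 n                        ≡⟨ cong (λ q → ψ 1 n + 1 * q + suc n * q) (ψ₂ n) ⟩
    ψ 1 n + 1 * (n * ψ 1 n + 1) + suc n * (n * ψ 1 n + 1)
      ≡⟨ solve 2 (λ n v → v :+ con 1 :* (n :* v :+ con 1) :+ (con 1 :+ n) :* (n :* v :+ con 1)
                         := (con 1 :+ n) :* (v :+ con 1 :* (n :* v :+ con 1)) :+ con 1) refl n (ψ 1 n) ⟩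
    suc n * (ψ 1 n + 1 * (n * ψ 1 n + 1)) + 1                ≡⟨ cong (λ q → suc n * (ψ 1 n + 1 * q) + 1) (ψ₂ n) ⟨
    suc n * ψ 1 (suc n) + 1                                  ∎
    where open ≡-Reasoning

  ψ₁-suc : ∀ n → ψ 1 (suc n) ≡ suc n * ψ 1 n + 1
  ψ₁-suc n = begin
    ψ 1 n + 1 * ψ 2 n                ≡⟨ cong (λ q → ψ 1 n + 1 * q) (ψ₂ n) ⟩
    ψ 1 n + 1 * (n * ψ 1 n + 1)      ≡⟨ solve 2 (λ n v → v :+ con 1 :* (n :* v :+ con 1) := (con 1 :+ n) :* v :+ con 1)
                                               refl n (ψ 1 n) ⟩
    suc n * ψ 1 n + 1                ∎
    where open ≡-Reasoning

  facePoly-DSC : ∀ n y → facePoly y (DSC n) ≡ y * ψ (suc y) n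
  facePoly-DSC zero y = +-identityʳ (y * 1)
  facePoly-DSC (suc n) y = begin
    facePoly y (DSC (suc n))
      ≡⟨ cong (facePoly y) (DSC-suc n) ⟩
    facePoly y (K ++ conesOver (freshLabels K) K)
      ≡⟨ facePoly-++ y K _ ⟩
    facePoly y K + facePoly y (conesOver (freshLabels K) K)
      ≡⟨ cong (facePoly y K +_) (facePoly-conesOver y (freshLabels K) K (≤-reflexive (sym (length-freshLabels K)))) ⟩
    facePoly y K + y * facePoly (suc y) K
      ≡⟨ cong₂ (λ a b → a + y * b) (facePoly-DSC n y) (facePoly-DSC n (suc y)) ⟩
    y * ψ (suc y) n + y * (suc y * ψ (suc (suc y)) n)
      ≡⟨ *-distribˡ-+ y _ _ ⟨
    y * ψ (suc y) (suc n) ∎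
    where
    open ≡-Reasoning
    K : Complex
    K = DSC n

  length-DSC : ∀ n → length (DSC n) ≡ ψ 2 n
  length-DSC n = trans (length≡facePoly₁ (DSC n)) (trans (facePoly-DSC n 1) (*-identityˡ (ψ 2 n)))

  ∈-subsets⁻ : ∀ σ {τ z} → τ ∈ subsets σ → z ∈ τ → z ∈ σ
  ∈-subsets⁻ [] (here refl) ()
  ∈-subsets⁻ (x ∷ σ) τ∈ z∈τ with ∈-++⁻ (subsets σ) τ∈
  ... | inj₁ τ∈σ = there (∈-subsets⁻ σ τ∈σ z∈τ)
  ... | inj₂ τ∈xσ with τ′ , τ′∈ , refl ← ∈-map⁻ (x ∷_) τ∈xσ with z∈τ
  ...   | here z≡x = here z≡x
  ...   | there z∈τ′ = there (∈-subsets⁻ σ τ′∈ z∈τ′)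

  []∈subsets : ∀ σ → [] ∈ subsets σ
  []∈subsets [] = here refl
  []∈subsets (x ∷ σ) = ∈-++⁺ˡ ([]∈subsets σ)

  ∈-cone⁻ : ∀ w σ {z} → z ∈ concat (cone w σ) → z ∈ σ ⊎ z ≡ w
  ∈-cone⁻ w σ z∈ with τ , z∈τ , τ∈ ← ∈-concat⁻′ (cone w σ) z∈
                  with τ′ , τ′∈ , refl ← ∈-map⁻ (_++ [ w ]) τ∈
                  with ∈-++⁻ τ′ z∈τ
  ... | inj₁ z∈τ′ = inj₁ (∈-subsets⁻ σ τ′∈ z∈τ′)
  ... | inj₂ (here z≡w) = inj₂ z≡w

  ∈-cone⁺ : ∀ w σ → w ∈ concat (cone w σ)
  ∈-cone⁺ w σ = ∈-concat⁺′ (here refl) (∈-map⁺ (_++ [ w ]) ([]∈subsets σ))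

  ∈-concat-++⁻ : ∀ (K L : Complex) {z} → z ∈ concat (K ++ L) → z ∈ concat K ⊎ z ∈ concat L
  ∈-concat-++⁻ K L z∈ = ∈-++⁻ (concat K) (subst (_ ∈_) (sym (concat-++ K L)) z∈)

  ∈-concat-++⁺ˡ : ∀ (K L : Complex) {z} → z ∈ concat K → z ∈ concat (K ++ L)
  ∈-concat-++⁺ˡ K L z∈ = subst (_ ∈_) (concat-++ K L) (∈-++⁺ˡ z∈)

  ∈-concat-++⁺ʳ : ∀ (K L : Complex) {z} → z ∈ concat L → z ∈ concat (K ++ L)
  ∈-concat-++⁺ʳ K L z∈ = subst (_ ∈_) (concat-++ K L) (∈-++⁺ʳ (concat K) z∈)

  ∈-conesOver⁻ : ∀ ws K {z} → z ∈ concat (conesOver ws K) → z ∈ concat K ⊎ z ∈ ws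
  ∈-conesOver⁻ (w ∷ ws) (σ ∷ K) z∈ with ∈-concat-++⁻ (cone w σ) (conesOver ws K) z∈
  ... | inj₁ z∈cone with ∈-cone⁻ w σ z∈cone
  ...   | inj₁ z∈σ = inj₁ (∈-++⁺ˡ z∈σ)
  ...   | inj₂ z≡w = inj₂ (here z≡w)
  ∈-conesOver⁻ (w ∷ ws) (σ ∷ K) z∈ | inj₂ z∈rest with ∈-conesOver⁻ ws K z∈rest
  ...   | inj₁ z∈K = inj₁ (∈-++⁺ʳ σ z∈K)
  ...   | inj₂ z∈ws = inj₂ (there z∈ws)

  ∈-conesOver⁺ : ∀ ws K {w} → length ws ≤ length K → w ∈ ws → w ∈ concat (conesOver ws K)
  ∈-conesOver⁺ (w ∷ ws) (σ ∷ K) _ (here refl) = ∈-concat-++⁺ˡ (cone w σ) _ (∈-cone⁺ w σ)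
  ∈-conesOver⁺ (w ∷ ws) (σ ∷ K) (s≤s len) (there w∈) =
    ∈-concat-++⁺ʳ (cone w σ) _ (∈-conesOver⁺ ws K len w∈)

  ∈-coneExtension : ∀ ws K → length ws ≡ length K →
                    ∀ {z} → z ∈ concat (K ++ conesOver ws K) ⇔ (z ∈ concat K ⊎ z ∈ ws)
  ∈-coneExtension ws K len = mk⇔ to from
    where
    to : ∀ {z} → z ∈ concat (K ++ conesOver ws K) → z ∈ concat K ⊎ z ∈ ws
    to z∈ with ∈-concat-++⁻ K (conesOver ws K) z∈
    ... | inj₁ z∈K = inj₁ z∈K
    ... | inj₂ z∈cones = ∈-conesOver⁻ ws K z∈cones
    from : ∀ {z} → z ∈ concat K ⊎ z ∈ ws → z ∈ concat (K ++ conesOver ws K)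
    from (inj₁ z∈K) = ∈-concat-++⁺ˡ K _ z∈K
    from (inj₂ z∈ws) = ∈-concat-++⁺ʳ K _ (∈-conesOver⁺ ws K (≤-reflexive len) z∈ws)

  ∈-shifted-upTo⁻ : ∀ F L {z} → z ∈ map (F +_) (upTo L) → z < F + L
  ∈-shifted-upTo⁻ F L z∈ with i , i∈ , refl ← ∈-map⁻ (F +_) z∈ = +-monoʳ-< F (∈-upTo⁻ i∈)

  ∈-shifted-upTo⁺ : ∀ F L {z} → F ≤ z → z < F + L → z ∈ map (F +_) (upTo L)
  ∈-shifted-upTo⁺ F L {z} F≤z z<F+L =
    subst (_∈ map (F +_) (upTo L)) (m+[n∸m]≡n F≤z) (∈-map⁺ (F +_) (∈-upTo⁺ z∸F<L))
    where
    z∸F<L : z ∸ F < L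
    z∸F<L = +-cancelˡ-< F (z ∸ F) L (subst (_< F + L) (sym (m+[n∸m]≡n F≤z)) z<F+L)

  ≤-foldr-⊔ : ∀ xs {z} → z ∈ xs → z ≤ foldr _⊔_ 0 xs
  ≤-foldr-⊔ (x ∷ xs) (here refl) = m≤m⊔n x _
  ≤-foldr-⊔ (x ∷ xs) (there z∈) = ≤-trans (≤-foldr-⊔ xs z∈) (m≤n⊔m x _)

  foldr-⊔-lub : ∀ xs {m} → (∀ {z} → z ∈ xs → z ≤ m) → foldr _⊔_ 0 xs ≤ m
  foldr-⊔-lub [] _ = z≤n
  foldr-⊔-lub (x ∷ xs) bound = ⊔-lub (bound (here refl)) (foldr-⊔-lub xs (bound ∘ there))

  fresh-range : ∀ K {m} → 0 < m → (∀ {z} → z ∈ concat K ⇔ z < m) → fresh K ≡ m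
  fresh-range K {suc m} _ range = cong suc (≤-antisym
    (foldr-⊔-lub (concat K) (λ z∈ → s≤s⁻¹ (Equivalence.to range z∈)))
    (≤-foldr-⊔ (concat K) (Equivalence.from range ≤-refl)))

  ∈-DSC : ∀ n {z} → z ∈ concat (DSC n) ⇔ z < ψ 1 n
  ∈-DSC zero = mk⇔ (λ { (here refl) → s≤s z≤n }) (λ { (s≤s z≤n) → here refl })
  ∈-DSC (suc n) {z} = mk⇔
    (λ z∈ → to (Equivalence.to extension (subst (z ∈_) (cong concat (DSC-suc n)) z∈)))
    (λ z< → subst (z ∈_) (cong concat (sym (DSC-suc n))) (Equivalence.from extension (from z<)))
    where
    K : Complex
    K = DSC n
    extension : z ∈ concat (K ++ conesOver (freshLabels K) K) ⇔ (z ∈ concat K ⊎ z ∈ freshLabels K)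
    extension = ∈-coneExtension (freshLabels K) K (length-freshLabels K)
    fresh≡ : fresh K ≡ ψ 1 n
    fresh≡ = fresh-range K (ψ-pos 1 n) (∈-DSC n)
    top≡ : fresh K + length K ≡ ψ 1 (suc n)
    top≡ = cong₂ _+_ fresh≡ (trans (length-DSC n) (sym (*-identityˡ (ψ 2 n))))
    to : z ∈ concat K ⊎ z ∈ freshLabels K → z < ψ 1 (suc n)
    to (inj₁ z∈K) = ≤-trans (Equivalence.to (∈-DSC n) z∈K) (m≤m+n _ _)
    to (inj₂ z∈labels) = subst (z <_) top≡ (∈-shifted-upTo⁻ (fresh K) (length K) z∈labels)
    from : z < ψ 1 (suc n) → z ∈ concat K ⊎ z ∈ freshLabels K
    from z< with z <? ψ 1 n
    ... | yes z<ψ = inj₁ (Equivalence.from (∈-DSC n) z<ψ)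
    ... | no z≮ψ = inj₂ (∈-shifted-upTo⁺ (fresh K) (length K)
                           (subst (_≤ z) (sym fresh≡) (≮⇒≥ z≮ψ)) (subst (z <_) (sym top≡) z<))

  length-deduplicate-range : ∀ xs m → (∀ {z} → z ∈ xs ⇔ z < m) → length (deduplicate _≟_ xs) ≡ m
  length-deduplicate-range xs m range =
    trans (↭-length (∼bag⇒↭ (unique∧set⇒bag (deduplicate-! xs) (upTo⁺ m) same))) (length-upTo m)
    where
    same : ∀ {z} → z ∈ deduplicate _≟_ xs ⇔ z ∈ upTo m
    same = mk⇔ (∈-upTo⁺ ∘ Equivalence.to range ∘ ∈-deduplicate⁻ _≟_ xs)
               (∈-deduplicate⁺ _≟_ ∘ Equivalence.from range ∘ ∈-upTo⁻)

  N₀≡ψ₁ : ∀ n → N₀ n ≡ ψ 1 n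
  N₀≡ψ₁ n = length-deduplicate-range (concat (DSC n)) (ψ 1 n) (∈-DSC n)

  N₀-suc : ∀ n → N₀ (suc n) ≡ suc n * N₀ n + 1
  N₀-suc n = begin
    N₀ (suc n)          ≡⟨ N₀≡ψ₁ (suc n) ⟩
    ψ 1 (suc n)         ≡⟨ ψ₁-suc n ⟩
    suc n * ψ 1 n + 1   ≡⟨ cong (λ v → suc n * v + 1) (N₀≡ψ₁ n) ⟨
    suc n * N₀ n + 1    ∎
    where open ≡-Reasoning

module ExponentialSeries where

  open import Data.Nat as ℕ using (ℕ; zero; suc; _!; NonZero)
  import Data.Nat.Properties as ℕ
  open import Data.Nat.Properties using (_!≢0; m^n≢0)
  import Data.Integer as ℤ
  import Data.Integer.Properties as ℤ
  open import Data.Rational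
    using (ℚ; 0ℚ; 1ℚ; _+_; _*_; _-_; _/_; _≤_; _<_; ∣_∣; toℚᵘ; +-*-rawSemiring; positive; nonNegative)
  open import Data.Rational.Properties
  open import Data.Rational.Unnormalised as ℚᵘ using (mkℚᵘ; *≡*; _≃_)
  import Data.Rational.Unnormalised.Properties as ℚᵘ
  open import Data.Rational.Solver using (module +-*-Solver)
  open import Algebra.Definitions.RawSemiring +-*-rawSemiring using (_^_)
  open import Data.List using (List; []; _∷_; _++_; [_]; map; upTo)
  open import Data.List.Properties using (upTo-∷ʳ; map-++)
  open import Data.Product using (∃-syntax; _,_)
  open import Function using (_∘_)
  open import Relation.Binary.PropositionalEquality hiding ([_])
  open +-*-Solver
  open VertexCount using (N₀-suc)

  toℚᵘ-ℕtoℚ : ∀ a → toℚᵘ (ℕtoℚ a) ≃ mkℚᵘ (ℤ.+ a) 0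
  toℚᵘ-ℕtoℚ a = toℚᵘ-fromℚᵘ (mkℚᵘ (ℤ.+ a) 0)

  ℕtoℚ-+ : ∀ a b → ℕtoℚ (a ℕ.+ b) ≡ ℕtoℚ a + ℕtoℚ b
  ℕtoℚ-+ a b = toℚᵘ-injective (begin
    toℚᵘ (ℕtoℚ (a ℕ.+ b))               ≈⟨ toℚᵘ-ℕtoℚ (a ℕ.+ b) ⟩
    mkℚᵘ (ℤ.+ (a ℕ.+ b)) 0              ≈⟨ *≡* (cong (ℤ._* ℤ.+ 1) (trans (ℤ.pos-+ a b)
                                               (sym (cong₂ ℤ._+_ (ℤ.*-identityʳ (ℤ.+ a)) (ℤ.*-identityʳ (ℤ.+ b)))))) ⟩
    mkℚᵘ (ℤ.+ a) 0 ℚᵘ.+ mkℚᵘ (ℤ.+ b) 0  ≈⟨ ℚᵘ.+-cong (toℚᵘ-ℕtoℚ a) (toℚᵘ-ℕtoℚ b) ⟨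
    toℚᵘ (ℕtoℚ a) ℚᵘ.+ toℚᵘ (ℕtoℚ b)    ≈⟨ toℚᵘ-homo-+ (ℕtoℚ a) (ℕtoℚ b) ⟨
    toℚᵘ (ℕtoℚ a + ℕtoℚ b)              ∎)
    where open ℚᵘ.≃-Reasoning

  ℕtoℚ-* : ∀ a b → ℕtoℚ (a ℕ.* b) ≡ ℕtoℚ a * ℕtoℚ b
  ℕtoℚ-* a b = toℚᵘ-injective (begin
    toℚᵘ (ℕtoℚ (a ℕ.* b))               ≈⟨ toℚᵘ-ℕtoℚ (a ℕ.* b) ⟩
    mkℚᵘ (ℤ.+ (a ℕ.* b)) 0              ≈⟨ *≡* (cong (ℤ._* ℤ.+ 1) (ℤ.pos-* a b)) ⟩
    mkℚᵘ (ℤ.+ a) 0 ℚᵘ.* mkℚᵘ (ℤ.+ b) 0  ≈⟨ ℚᵘ.*-cong (toℚᵘ-ℕtoℚ a) (toℚᵘ-ℕtoℚ b) ⟨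
    toℚᵘ (ℕtoℚ a) ℚᵘ.* toℚᵘ (ℕtoℚ b)    ≈⟨ toℚᵘ-homo-* (ℕtoℚ a) (ℕtoℚ b) ⟨
    toℚᵘ (ℕtoℚ a * ℕtoℚ b)              ∎)
    where open ℚᵘ.≃-Reasoning

  ℕtoℚ-^ : ∀ a k → ℕtoℚ (a ℕ.^ k) ≡ ℕtoℚ a ^ k
  ℕtoℚ-^ a zero = refl
  ℕtoℚ-^ a (suc k) = trans (ℕtoℚ-* a (a ℕ.^ k)) (cong (ℕtoℚ a *_) (ℕtoℚ-^ a k))

  ℕtoℚ-*-inverse : ∀ a .{{_ : NonZero a}} → ℕtoℚ a * (ℤ.+ 1 / a) ≡ 1ℚ
  ℕtoℚ-*-inverse (suc a) = toℚᵘ-injective (begin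
    toℚᵘ (ℕtoℚ (suc a) * (ℤ.+ 1 / suc a))
      ≈⟨ toℚᵘ-homo-* (ℕtoℚ (suc a)) (ℤ.+ 1 / suc a) ⟩
    toℚᵘ (ℕtoℚ (suc a)) ℚᵘ.* toℚᵘ (ℤ.+ 1 / suc a)
      ≈⟨ ℚᵘ.*-cong (toℚᵘ-ℕtoℚ (suc a)) (toℚᵘ-fromℚᵘ (mkℚᵘ (ℤ.+ 1) a)) ⟩
    mkℚᵘ (ℤ.+ suc a) 0 ℚᵘ.* mkℚᵘ (ℤ.+ 1) a
      ≈⟨ *≡* (trans (ℤ.*-identityʳ _) (trans (ℤ.*-identityʳ _)
               (sym (trans (ℤ.*-identityˡ _) (cong ℤ.+_ (ℕ.*-identityˡ (suc a))))))) ⟩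
    toℚᵘ 1ℚ ∎)
    where open ℚᵘ.≃-Reasoning

  ℕtoℚ-nonNeg : ∀ a → 0ℚ ≤ ℕtoℚ a
  ℕtoℚ-nonNeg a = nonNegative⁻¹ (ℕtoℚ a) {{normalize-nonNeg a 1}}

  ℕtoℚ-pos : ∀ a .{{_ : NonZero a}} → 0ℚ < ℕtoℚ a
  ℕtoℚ-pos a = positive⁻¹ (ℕtoℚ a) {{normalize-pos a 1}}

  ℕtoℚ-mono-≤ : ∀ {a b} → a ℕ.≤ b → ℕtoℚ a ≤ ℕtoℚ b
  ℕtoℚ-mono-≤ {a} {b} a≤b = begin
    ℕtoℚ a                     ≡⟨ +-identityʳ (ℕtoℚ a) ⟨
    ℕtoℚ a + 0ℚ                ≤⟨ +-monoʳ-≤ (ℕtoℚ a) (ℕtoℚ-nonNeg (b ℕ.∸ a)) ⟩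
    ℕtoℚ a + ℕtoℚ (b ℕ.∸ a)    ≡⟨ ℕtoℚ-+ a (b ℕ.∸ a) ⟨
    ℕtoℚ (a ℕ.+ (b ℕ.∸ a))     ≡⟨ cong ℕtoℚ (ℕ.m+[n∸m]≡n a≤b) ⟩
    ℕtoℚ b                     ∎
    where open ≤-Reasoning

  nonNeg-+ : ∀ {p q} → 0ℚ ≤ p → 0ℚ ≤ q → 0ℚ ≤ p + q
  nonNeg-+ {p} {q} 0≤p 0≤q =
    nonNegative⁻¹ _ {{nonNeg+nonNeg⇒nonNeg p {{nonNegative 0≤p}} q {{nonNegative 0≤q}}}}

  nonNeg-* : ∀ {p q} → 0ℚ ≤ p → 0ℚ ≤ q → 0ℚ ≤ p * q
  nonNeg-* {p} {q} 0≤p 0≤q =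
    nonNegative⁻¹ _ {{nonNeg*nonNeg⇒nonNeg p {{nonNegative 0≤p}} q {{nonNegative 0≤q}}}}

  pos-* : ∀ {p q} → 0ℚ < p → 0ℚ < q → 0ℚ < p * q
  pos-* {p} {q} 0<p 0<q = positive⁻¹ _ {{pos*pos⇒pos p {{positive 0<p}} q {{positive 0<q}}}}

  ^-pos : ∀ {ν} k → 0ℚ < ν → 0ℚ < ν ^ k
  ^-pos zero _ = ℕtoℚ-pos 1
  ^-pos (suc k) 0<ν = pos-* 0<ν (^-pos k 0<ν)

  sumℚ-++ : ∀ xs ys → sumℚ (xs ++ ys) ≡ sumℚ xs + sumℚ ys
  sumℚ-++ [] ys = sym (+-identityˡ (sumℚ ys))
  sumℚ-++ (x ∷ xs) ys = trans (cong (x +_) (sumℚ-++ xs ys)) (sym (+-assoc x _ _))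

  sumℚ-upTo-suc : ∀ (f : ℕ → ℚ) m → sumℚ (map f (upTo (suc m))) ≡ sumℚ (map f (upTo m)) + f m
  sumℚ-upTo-suc f m = begin
    sumℚ (map f (upTo (suc m)))           ≡⟨ cong (sumℚ ∘ map f) (upTo-∷ʳ m) ⟨
    sumℚ (map f (upTo m ++ [ m ]))        ≡⟨ cong sumℚ (map-++ f (upTo m) [ m ]) ⟩
    sumℚ (map f (upTo m) ++ [ f m ])      ≡⟨ sumℚ-++ (map f (upTo m)) [ f m ] ⟩
    sumℚ (map f (upTo m)) + (f m + 0ℚ)    ≡⟨ cong (sumℚ (map f (upTo m)) +_) (+-identityʳ (f m)) ⟩
    sumℚ (map f (upTo m)) + f m           ∎
    where open ≡-Reasoning

  eSum-+ : ∀ n m → eSum (n ℕ.+ m) ≡ eSum n + tailSum n m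
  eSum-+ n zero = trans (cong eSum (ℕ.+-identityʳ n)) (sym (+-identityʳ (eSum n)))
  eSum-+ n (suc m) = begin
    eSum (n ℕ.+ suc m)                              ≡⟨ cong eSum (ℕ.+-suc n m) ⟩
    eSum (suc (n ℕ.+ m))                            ≡⟨ sumℚ-upTo-suc invFact (suc (n ℕ.+ m)) ⟩
    eSum (n ℕ.+ m) + invFact (suc (n ℕ.+ m))        ≡⟨ cong₂ _+_ (eSum-+ n m) (cong invFact (sym (ℕ.+-suc n m))) ⟩
    eSum n + tailSum n m + invFact (n ℕ.+ suc m)    ≡⟨ +-assoc (eSum n) _ _ ⟩
    eSum n + (tailSum n m + invFact (n ℕ.+ suc m))  ≡⟨ cong (eSum n +_) (sumℚ-upTo-suc (λ j → invFact (n ℕ.+ suc j)) m) ⟨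
    eSum n + tailSum n (suc m)                      ∎
    where open ≡-Reasoning

  ℕtoℚ-N₀-suc : ∀ n → ℕtoℚ (N₀ (suc n)) ≡ ℕtoℚ (suc n) * ℕtoℚ (N₀ n) + 1ℚ
  ℕtoℚ-N₀-suc n = trans (cong ℕtoℚ (N₀-suc n))
    (trans (ℕtoℚ-+ (suc n ℕ.* N₀ n) 1) (cong (_+ 1ℚ) (ℕtoℚ-* (suc n) (N₀ n))))

  N₀≡n!eSum : ∀ n → ℕtoℚ (N₀ n) ≡ ℕtoℚ (n !) * eSum n
  N₀≡n!eSum zero = refl
  N₀≡n!eSum (suc n) = begin
    ℕtoℚ (N₀ (suc n))                      ≡⟨ ℕtoℚ-N₀-suc n ⟩
    s * ℕtoℚ (N₀ n) + 1ℚ                   ≡⟨ cong₂ (λ a b → s * a + b) (N₀≡n!eSum n)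
                                                     (sym (ℕtoℚ-*-inverse (suc n !) {{suc n !≢0}})) ⟩
    s * (f * eSum n) + ℕtoℚ (suc n !) * i  ≡⟨ cong (λ a → s * (f * eSum n) + a * i) (ℕtoℚ-* (suc n) (n !)) ⟩
    s * (f * eSum n) + s * f * i           ≡⟨ solve 4 (λ s f e i → s :* (f :* e) :+ s :* f :* i := s :* f :* (e :+ i))
                                                       refl s f (eSum n) i ⟩
    s * f * (eSum n + i)                   ≡⟨ cong₂ _*_ (ℕtoℚ-* (suc n) (n !)) (sumℚ-upTo-suc invFact (suc n)) ⟨
    ℕtoℚ (suc n !) * eSum (suc n)          ∎
    where
    open ≡-Reasoning
    s f i : ℚ
    s = ℕtoℚ (suc n)
    f = ℕtoℚ (n !)
    i = invFact (suc n)

  N₀-tail-formula : ∀ n m → ℕtoℚ (N₀ n) ≡ ℕtoℚ (n !) * (eSum (n ℕ.+ m) - tailSum n m)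
  N₀-tail-formula n m = trans (N₀≡n!eSum n) (cong (ℕtoℚ (n !) *_) (sym (begin
    eSum (n ℕ.+ m) - tailSum n m          ≡⟨ cong (_- tailSum n m) (eSum-+ n m) ⟩
    eSum n + tailSum n m - tailSum n m    ≡⟨ solve 2 (λ e t → e :+ t :- t := e) refl (eSum n) (tailSum n m) ⟩
    eSum n                                ∎)))
    where open ≡-Reasoning

  -- By N₀≡n!eSum this is n! Σ_{n<i≤n+k} 1/i!, which tends to e·n! − N₀ n as k → ∞.
  remainder : ℕ → ℕ → ℚ
  remainder n k = ℕtoℚ (n !) * eSum (n ℕ.+ k) - ℕtoℚ (N₀ n)

  remainder-zero : ∀ n → remainder n 0 ≡ 0ℚ
  remainder-zero n = begin
    ℕtoℚ (n !) * eSum (n ℕ.+ 0) - ℕtoℚ (N₀ n)  ≡⟨ cong (λ m → ℕtoℚ (n !) * eSum m - ℕtoℚ (N₀ n)) (ℕ.+-identityʳ n) ⟩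
    ℕtoℚ (n !) * eSum n - ℕtoℚ (N₀ n)          ≡⟨ cong (_- ℕtoℚ (N₀ n)) (N₀≡n!eSum n) ⟨
    ℕtoℚ (N₀ n) - ℕtoℚ (N₀ n)                  ≡⟨ +-inverseʳ (ℕtoℚ (N₀ n)) ⟩
    0ℚ                                         ∎
    where open ≡-Reasoning

  remainder-suc : ∀ n k → ℕtoℚ (suc n) * remainder n (suc k) ≡ 1ℚ + remainder (suc n) k
  remainder-suc n k = begin
    s * (f * eSum (n ℕ.+ suc k) - N)   ≡⟨ cong (λ m → s * (f * eSum m - N)) (ℕ.+-suc n k) ⟩
    s * (f * e - N)                    ≡⟨ solve 4 (λ s f e N → s :* (f :* e :- N)
                                                          := con 1ℚ :+ (s :* f :* e :- (s :* N :+ con 1ℚ)))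
                                                  refl s f e N ⟩
    1ℚ + (s * f * e - (s * N + 1ℚ))    ≡⟨ cong₂ (λ a b → 1ℚ + (a * e - b)) (ℕtoℚ-* (suc n) (n !)) (ℕtoℚ-N₀-suc n) ⟨
    1ℚ + remainder (suc n) k           ∎
    where
    open ≡-Reasoning
    s f N e : ℚ
    s = ℕtoℚ (suc n)
    f = ℕtoℚ (n !)
    N = ℕtoℚ (N₀ n)
    e = eSum (suc n ℕ.+ k)

  remainder-nonNeg : ∀ n k → 0ℚ ≤ remainder n k
  remainder-nonNeg n zero = ≤-reflexive (sym (remainder-zero n))
  remainder-nonNeg n (suc k) = *-cancelˡ-≤-pos (ℕtoℚ (suc n)) {{positive (ℕtoℚ-pos (suc n))}} (begin
    ℕtoℚ (suc n) * 0ℚ                   ≡⟨ *-zeroʳ (ℕtoℚ (suc n)) ⟩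
    0ℚ                                  ≤⟨ nonNeg-+ (ℕtoℚ-nonNeg 1) (remainder-nonNeg (suc n) k) ⟩
    1ℚ + remainder (suc n) k            ≡⟨ remainder-suc n k ⟨
    ℕtoℚ (suc n) * remainder n (suc k)  ∎)
    where open ≤-Reasoning

  remainder-bound : ∀ n k → ℕtoℚ n * remainder n k ≤ 1ℚ
  remainder-bound n zero = begin
    ℕtoℚ n * remainder n 0  ≡⟨ cong (ℕtoℚ n *_) (remainder-zero n) ⟩
    ℕtoℚ n * 0ℚ             ≡⟨ *-zeroʳ (ℕtoℚ n) ⟩
    0ℚ                      ≤⟨ ℕtoℚ-nonNeg 1 ⟩
    1ℚ                      ∎
    where open ≤-Reasoning
  remainder-bound n (suc k) = *-cancelˡ-≤-pos s {{positive (ℕtoℚ-pos (suc n))}} (begin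
    s * (ν * r)    ≡⟨ solve 3 (λ s ν r → s :* (ν :* r) := ν :* (s :* r)) refl s ν r ⟩
    ν * (s * r)    ≡⟨ cong (ν *_) (remainder-suc n k) ⟩
    ν * (1ℚ + r′)  ≡⟨ solve 2 (λ ν r′ → ν :* (con 1ℚ :+ r′) := ν :+ ν :* r′) refl ν r′ ⟩
    ν + ν * r′     ≤⟨ +-monoʳ-≤ ν ν*r′≤1 ⟩
    ν + 1ℚ         ≡⟨ solve 1 (λ ν → ν :+ con 1ℚ := (con 1ℚ :+ ν) :* con 1ℚ) refl ν ⟩
    (1ℚ + ν) * 1ℚ  ≡⟨ cong (_* 1ℚ) (ℕtoℚ-+ 1 n) ⟨
    s * 1ℚ         ∎)
    where
    open ≤-Reasoning
    s ν r r′ : ℚ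
    s = ℕtoℚ (suc n)
    ν = ℕtoℚ n
    r = remainder n (suc k)
    r′ = remainder (suc n) k
    ν*r′≤1 : ν * r′ ≤ 1ℚ
    ν*r′≤1 = ≤-trans (*-monoʳ-≤-nonNeg r′ {{nonNegative (remainder-nonNeg (suc n) k)}} (ℕtoℚ-mono-≤ (ℕ.n≤1+n n)))
                     (remainder-bound (suc n) k)

  -- For ν = n: rising ν j = (n+j)!/n! and tailNumerator ν j = (n+j)! Σ_{n<i≤n+j} 1/i!.
  rising : ℚ → ℕ → ℚ
  rising ν zero = 1ℚ
  rising ν (suc j) = (ℕtoℚ (suc j) + ν) * rising ν j

  tailNumerator : ℚ → ℕ → ℚ
  tailNumerator ν zero = 0ℚ
  tailNumerator ν (suc j) = (ℕtoℚ (suc j) + ν) * tailNumerator ν j + 1ℚ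

  rising-pos : ∀ {ν} j → 0ℚ ≤ ν → 0ℚ < rising ν j
  rising-pos zero _ = ℕtoℚ-pos 1
  rising-pos {ν} (suc j) 0≤ν =
    pos-* (subst (_< ℕtoℚ (suc j) + ν) (+-identityʳ 0ℚ) (+-mono-<-≤ (ℕtoℚ-pos (suc j)) 0≤ν)) (rising-pos j 0≤ν)

  remainder-unfold : ∀ n j k →
    rising (ℕtoℚ n) j * remainder n (j ℕ.+ k) ≡ tailNumerator (ℕtoℚ n) j + remainder (j ℕ.+ n) k
  remainder-unfold n zero k = trans (*-identityˡ (remainder n k)) (sym (+-identityˡ (remainder n k)))
  remainder-unfold n (suc j) k = begin
    s * R * remainder n (suc (j ℕ.+ k))                       ≡⟨ cong (λ i → s * R * remainder n i) (ℕ.+-suc j k) ⟨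
    s * R * remainder n (j ℕ.+ suc k)                         ≡⟨ *-assoc s R _ ⟩
    s * (R * remainder n (j ℕ.+ suc k))                       ≡⟨ cong (s *_) (remainder-unfold n j (suc k)) ⟩
    s * (T + remainder (j ℕ.+ n) (suc k))                     ≡⟨ *-distribˡ-+ s T _ ⟩
    s * T + s * remainder (j ℕ.+ n) (suc k)                   ≡⟨ cong (λ a → s * T + a * remainder (j ℕ.+ n) (suc k))
                                                                       (ℕtoℚ-+ (suc j) n) ⟨
    s * T + ℕtoℚ (suc j ℕ.+ n) * remainder (j ℕ.+ n) (suc k)  ≡⟨ cong (s * T +_) (remainder-suc (j ℕ.+ n) k) ⟩
    s * T + (1ℚ + remainder (suc j ℕ.+ n) k)                  ≡⟨ +-assoc (s * T) 1ℚ _ ⟨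
    s * T + 1ℚ + remainder (suc j ℕ.+ n) k                    ∎
    where
    open ≡-Reasoning
    s R T : ℚ
    s = ℕtoℚ (suc j) + ℕtoℚ n
    R = rising (ℕtoℚ n) j
    T = tailNumerator (ℕtoℚ n) j

  horner : List ℕ → ℚ → ℚ
  horner [] ν = 0ℚ
  horner (c ∷ cs) ν = ℕtoℚ c + ν * horner cs ν

  horner-nonNeg : ∀ cs {ν} → 0ℚ ≤ ν → 0ℚ ≤ horner cs ν
  horner-nonNeg [] _ = ≤-refl
  horner-nonNeg (c ∷ cs) 0≤ν = nonNeg-+ (ℕtoℚ-nonNeg c) (nonNeg-* 0≤ν (horner-nonNeg cs 0≤ν))

  scaled-error-identity : ∀ ν t →
    ν ^ 6 * (tailNumerator ν 5 + t) - rising ν 5 * (ν ^ 5 - ν ^ 3 + (ν ^ 2 + ℕtoℚ 2 * ν))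
      ≡ ν ^ 6 * t - horner (0 ∷ 240 ∷ 668 ∷ 604 ∷ 121 ∷ 10 ∷ []) ν
  scaled-error-identity = solve 2 (λ ν t →
    let s : ℕ → _
        s i = con (ℕtoℚ i) :+ ν
        h : ℕ → _ → _
        h c p = con (ℕtoℚ c) :+ ν :* p
    in ν :^ 6 :* ((s 5 :* (s 4 :* (s 3 :* (s 2 :* (s 1 :* con 0ℚ :+ con 1ℚ) :+ con 1ℚ) :+ con 1ℚ) :+ con 1ℚ) :+ con 1ℚ) :+ t)
       :- (s 5 :* (s 4 :* (s 3 :* (s 2 :* (s 1 :* con 1ℚ))))) :* (ν :^ 5 :- ν :^ 3 :+ (ν :^ 2 :+ con (ℕtoℚ 2) :* ν))
    := ν :^ 6 :* t :- h 0 (h 240 (h 668 (h 604 (h 121 (h 10 (con 0ℚ))))))) refl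

  rising₅-split : ∀ ν → ℕtoℚ 11 * rising ν 5 ≡
    ν ^ 5 + horner (0 ∷ 240 ∷ 668 ∷ 604 ∷ 121 ∷ 10 ∷ []) ν + horner (1320 ∷ 2774 ∷ 1807 ∷ 331 ∷ 44 ∷ []) ν
  rising₅-split = solve 1 (λ ν →
    let s : ℕ → _
        s i = con (ℕtoℚ i) :+ ν
        h : ℕ → _ → _
        h c p = con (ℕtoℚ c) :+ ν :* p
    in con (ℕtoℚ 11) :* (s 5 :* (s 4 :* (s 3 :* (s 2 :* (s 1 :* con 1ℚ)))))
    := ν :^ 5 :+ h 0 (h 240 (h 668 (h 604 (h 121 (h 10 (con 0ℚ))))))
              :+ h 1320 (h 2774 (h 1807 (h 331 (h 44 (con 0ℚ)))))) refl

  -- Multiplied by D = ν⁶ (ν+1)⋯(ν+5) the error becomes ν⁶ t − P with P = ν (240 + 668 ν + ⋯),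
  -- and |ν⁶ t − P| ≤ ν⁵ + P ≤ 11 (ν+1)⋯(ν+5).
  expansion-error : ∀ {ν t r} (x : ℕ → ℚ) → 0ℚ < ν → 0ℚ ≤ t → ν * t ≤ 1ℚ →
                    (∀ k → ν ^ k * x k ≡ 1ℚ) → rising ν 5 * r ≡ tailNumerator ν 5 + t →
                    ∣ r - x 1 + x 3 - x 4 - ℕtoℚ 2 * x 5 ∣ ≤ ℕtoℚ 11 * x 6
  expansion-error {ν} {t} {r} x 0<ν 0≤t νt≤1 inverse unfold = *-cancelˡ-≤-pos D {{positive 0<D}} (begin
    D * ∣ E ∣              ≡⟨ cong (_* ∣ E ∣) (0≤p⇒∣p∣≡p (<⇒≤ 0<D)) ⟨
    ∣ D ∣ * ∣ E ∣          ≡⟨ ∣p*q∣≡∣p∣*∣q∣ D E ⟨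
    ∣ D * E ∣              ≡⟨ cong ∣_∣ scaled ⟩
    ∣ ν ^ 6 * t - P ∣      ≤⟨ ∣p-q∣≤∣p∣+∣q∣ (ν ^ 6 * t) P ⟩
    ∣ ν ^ 6 * t ∣ + ∣ P ∣  ≡⟨ cong₂ _+_ (0≤p⇒∣p∣≡p (nonNeg-* (<⇒≤ (^-pos 6 0<ν)) 0≤t)) (0≤p⇒∣p∣≡p 0≤P) ⟩
    ν ^ 6 * t + P          ≤⟨ +-monoˡ-≤ P ν⁶t≤ν⁵ ⟩
    ν ^ 5 + P              ≡⟨ +-identityʳ (ν ^ 5 + P) ⟨
    ν ^ 5 + P + 0ℚ         ≤⟨ +-monoʳ-≤ (ν ^ 5 + P) (horner-nonNeg (1320 ∷ 2774 ∷ 1807 ∷ 331 ∷ 44 ∷ []) 0≤ν) ⟩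
    ν ^ 5 + P + H          ≡⟨ rising₅-split ν ⟨
    ℕtoℚ 11 * S            ≡⟨ scaled-bound ⟨
    D * (ℕtoℚ 11 * x 6)    ∎)
    where
    open ≤-Reasoning
    S D E P H : ℚ
    S = rising ν 5
    D = ν ^ 6 * S
    E = r - x 1 + x 3 - x 4 - ℕtoℚ 2 * x 5
    P = horner (0 ∷ 240 ∷ 668 ∷ 604 ∷ 121 ∷ 10 ∷ []) ν
    H = horner (1320 ∷ 2774 ∷ 1807 ∷ 331 ∷ 44 ∷ []) ν
    0≤ν : 0ℚ ≤ ν
    0≤ν = <⇒≤ 0<ν
    0<D : 0ℚ < D
    0<D = pos-* (^-pos 6 0<ν) (rising-pos 5 0≤ν)
    0≤P : 0ℚ ≤ P
    0≤P = horner-nonNeg (0 ∷ 240 ∷ 668 ∷ 604 ∷ 121 ∷ 10 ∷ []) 0≤ν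
    ν⁶t≤ν⁵ : ν ^ 6 * t ≤ ν ^ 5
    ν⁶t≤ν⁵ = begin
      ν ^ 6 * t        ≡⟨ solve 2 (λ ν t → ν :^ 6 :* t := ν :^ 5 :* (ν :* t)) refl ν t ⟩
      ν ^ 5 * (ν * t)  ≤⟨ *-monoˡ-≤-nonNeg (ν ^ 5) {{nonNegative (<⇒≤ (^-pos 5 0<ν))}} νt≤1 ⟩
      ν ^ 5 * 1ℚ       ≡⟨ *-identityʳ (ν ^ 5) ⟩
      ν ^ 5            ∎
    scaled : D * E ≡ ν ^ 6 * t - P
    scaled = begin-equality
      D * E
        ≡⟨ solve 7 (λ ν S r x₁ x₃ x₄ x₅ →
             ν :^ 6 :* S :* (r :- x₁ :+ x₃ :- x₄ :- con (ℕtoℚ 2) :* x₅)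
             := ν :^ 6 :* (S :* r) :- S :* (ν :^ 5 :* (ν :^ 1 :* x₁) :- ν :^ 3 :* (ν :^ 3 :* x₃)
                                          :+ (ν :^ 2 :* (ν :^ 4 :* x₄) :+ con (ℕtoℚ 2) :* ν :* (ν :^ 5 :* x₅))))
             refl ν S r (x 1) (x 3) (x 4) (x 5) ⟩
      ν ^ 6 * (S * r) - S * (ν ^ 5 * (ν ^ 1 * x 1) - ν ^ 3 * (ν ^ 3 * x 3)
                             + (ν ^ 2 * (ν ^ 4 * x 4) + ℕtoℚ 2 * ν * (ν ^ 5 * x 5)))
        ≡⟨ cong₂ (λ a b → ν ^ 6 * a - S * b) unfold
                 (cong₂ _+_ (cong₂ (λ a b → ν ^ 5 * a - ν ^ 3 * b) (inverse 1) (inverse 3))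
                            (cong₂ (λ a b → ν ^ 2 * a + ℕtoℚ 2 * ν * b) (inverse 4) (inverse 5))) ⟩
      ν ^ 6 * (tailNumerator ν 5 + t) - S * (ν ^ 5 * 1ℚ - ν ^ 3 * 1ℚ + (ν ^ 2 * 1ℚ + ℕtoℚ 2 * ν * 1ℚ))
        ≡⟨ cong (λ b → ν ^ 6 * (tailNumerator ν 5 + t) - S * b)
                (solve 4 (λ a b c ν → a :* con 1ℚ :- b :* con 1ℚ :+ (c :* con 1ℚ :+ con (ℕtoℚ 2) :* ν :* con 1ℚ)
                                      := a :- b :+ (c :+ con (ℕtoℚ 2) :* ν)) refl (ν ^ 5) (ν ^ 3) (ν ^ 2) ν) ⟩
      ν ^ 6 * (tailNumerator ν 5 + t) - S * (ν ^ 5 - ν ^ 3 + (ν ^ 2 + ℕtoℚ 2 * ν))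
        ≡⟨ scaled-error-identity ν t ⟩
      ν ^ 6 * t - P ∎
    scaled-bound : D * (ℕtoℚ 11 * x 6) ≡ ℕtoℚ 11 * S
    scaled-bound = begin-equality
      D * (ℕtoℚ 11 * x 6)          ≡⟨ solve 4 (λ ν S c y → ν :^ 6 :* S :* (c :* y) := c :* S :* (ν :^ 6 :* y))
                                              refl ν S (ℕtoℚ 11) (x 6) ⟩
      ℕtoℚ 11 * S * (ν ^ 6 * x 6)  ≡⟨ cong (ℕtoℚ 11 * S *_) (inverse 6) ⟩
      ℕtoℚ 11 * S * 1ℚ             ≡⟨ *-identityʳ (ℕtoℚ 11 * S) ⟩
      ℕtoℚ 11 * S                  ∎

  remainder-expansion : ∀ n .{{_ : NonZero n}} k →
    ∣ remainder n (5 ℕ.+ k) - invPow n 1 + invPow n 3 - invPow n 4 - ℕtoℚ 2 * invPow n 5 ∣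
      ≤ ℕtoℚ 11 * invPow n 6
  remainder-expansion n k =
    expansion-error (λ j → invPow n j) (ℕtoℚ-pos n) (remainder-nonNeg (5 ℕ.+ n) k) νt≤1 inverse
                    (remainder-unfold n 5 k)
    where
    νt≤1 : ℕtoℚ n * remainder (5 ℕ.+ n) k ≤ 1ℚ
    νt≤1 = ≤-trans (*-monoʳ-≤-nonNeg _ {{nonNegative (remainder-nonNeg (5 ℕ.+ n) k)}} (ℕtoℚ-mono-≤ (ℕ.m≤n+m n 5)))
                   (remainder-bound (5 ℕ.+ n) k)
    inverse : ∀ j → ℕtoℚ n ^ j * invPow n j ≡ 1ℚ
    inverse j = trans (cong (_* invPow n j) (sym (ℕtoℚ-^ n j))) (ℕtoℚ-*-inverse (n ℕ.^ j) {{m^n≢0 n j}})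

  -- Every truncation past n + 5 already satisfies the bound without ε.
  N₀-asymptotics : ∀ n .{{_ : NonZero n}} ε → 0ℚ < ε → ∃[ M ] (∀ m → M ℕ.≤ m →
    ∣ ℕtoℚ (n !) * eSum m - invPow n 1 + invPow n 3 - invPow n 4 - ℕtoℚ 2 * invPow n 5 - ℕtoℚ (N₀ n) ∣
      ≤ ℕtoℚ 11 * invPow n 6 + ε)
  N₀-asymptotics n ε 0<ε = n ℕ.+ 5 , bound
    where
    F N : ℚ
    F = ℕtoℚ (n !)
    N = ℕtoℚ (N₀ n)
    x : ℕ → ℚ
    x j = invPow n j
    bound : ∀ m → n ℕ.+ 5 ℕ.≤ m → ∣ F * eSum m - x 1 + x 3 - x 4 - ℕtoℚ 2 * x 5 - N ∣ ≤ ℕtoℚ 11 * x 6 + ε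
    bound m n+5≤m with k , refl ← ℕ.m≤n⇒∃[o]m+o≡n n+5≤m = begin
      ∣ F * eSum (n ℕ.+ 5 ℕ.+ k) - x 1 + x 3 - x 4 - ℕtoℚ 2 * x 5 - N ∣
        ≡⟨ cong ∣_∣ (solve 6 (λ a x₁ x₃ x₄ x₅ N → a :- x₁ :+ x₃ :- x₄ :- con (ℕtoℚ 2) :* x₅ :- N
                                               := a :- N :- x₁ :+ x₃ :- x₄ :- con (ℕtoℚ 2) :* x₅)
                                refl (F * eSum (n ℕ.+ 5 ℕ.+ k)) (x 1) (x 3) (x 4) (x 5) N) ⟩
      ∣ F * eSum (n ℕ.+ 5 ℕ.+ k) - N - x 1 + x 3 - x 4 - ℕtoℚ 2 * x 5 ∣
        ≡⟨ cong (λ i → ∣ F * eSum i - N - x 1 + x 3 - x 4 - ℕtoℚ 2 * x 5 ∣) (ℕ.+-assoc n 5 k) ⟩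
      ∣ remainder n (5 ℕ.+ k) - x 1 + x 3 - x 4 - ℕtoℚ 2 * x 5 ∣
        ≤⟨ remainder-expansion n k ⟩
      ℕtoℚ 11 * x 6       ≡⟨ +-identityʳ (ℕtoℚ 11 * x 6) ⟨
      ℕtoℚ 11 * x 6 + 0ℚ  ≤⟨ +-monoʳ-≤ (ℕtoℚ 11 * x 6) (<⇒≤ 0<ε) ⟩
      ℕtoℚ 11 * x 6 + ε   ∎
      where open ≤-Reasoning

open import Data.Nat using (ℕ; zero; suc; _+_; _*_; _≤_; _!; NonZero)
open import Data.Product using (_×_; ∃-syntax; _,_)
open import Relation.Binary.PropositionalEquality using (_≡_; refl)
open import Data.Rational as ℚ using (ℚ; 0ℚ)
open VertexCount using (N₀-suc)
open ExponentialSeries using (N₀-tail-formula; N₀-asymptotics)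

mainTheorem2 :
  (N₀ 0 ≡ 1)
  × (∀ n → N₀ (suc n) ≡ suc n * N₀ n + 1)
  -- N₀(n) = n! [ e - Σ_{k>n} 1/k! ], with e and the tail replaced by
  -- their matching partial sums up to index n + m, for every m
  × (∀ n m → ℕtoℚ (N₀ n) ≡ ℕtoℚ (n !) ℚ.* (eSum (n + m) ℚ.- tailSum n m))
  -- N₀(n) = e n! - 1/n + 1/n^3 - 1/n^4 - 2/n^5 + O(n^-6):
  -- ∃ C, n₀ such that for n ≥ n₀, | e n! - 1/n + 1/n³ - 1/n⁴ - 2/n⁵ - N₀(n) | ≤ C/n⁶,
  -- where e n! is the limit (m → ∞) of n! · eSum m
  × (∃[ C ] ∃[ n₀ ] (∀ (n : ℕ) .{{_ : NonZero n}} → n₀ ≤ n →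
      ∀ (ε : ℚ) → 0ℚ ℚ.< ε → ∃[ M ] (∀ m → M ≤ m →
        ℚ.∣ ℕtoℚ (n !) ℚ.* eSum m ℚ.- invPow n 1 ℚ.+ invPow n 3 ℚ.- invPow n 4
            ℚ.- ℕtoℚ 2 ℚ.* invPow n 5 ℚ.- ℕtoℚ (N₀ n) ∣
          ℚ.≤ C ℚ.* invPow n 6 ℚ.+ ε)))
mainTheorem2 = refl , N₀-suc , N₀-tail-formula , ℕtoℚ 11 , 0 , λ n _ → N₀-asymptotics n
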